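{- Let $n\in\mathbb{N}$ and let $F:\mathcal{M}(n)\to\mathcal{D}(n)$ be the map defined in the context. 1. For every $M\in\mathcal{M}(n)$, $nes(M)=dos(F(M))$; moreover there is a bijection between the set $\{nes(M):M\in\mathcal{M}(n)\}$ and $\mathcal{D}(n)$. 2. For every $D\in\mathcal{D}(n)$ and every integer $i$ with $0\le i\le ne(D)$ there is $M\in F^{ -1}(D)$ with $ne(M)=i$; and there is no $M\in F^{ -1}(D)$ with $ne(M)>ne(D)$.
   Context: A matching on $[2n]$ is a partition of $[2n]$ into $n$ two-element blocks (edges); $\mathcal{M}(n)$ is the set of such matchings; $ne(M)$ is the number of pairs of edges $A,B$ with $\min A<\min B<\max B<\max A$. Gaps are numbered $1,\dots,2n+1$ (gap 1 before 1, gap $j$ between $j-1$ and $j$, gap $2n+1$ after $2n$); the nesting sequence $nes(M)$ has as $j$-th term the number of edges $\{p,q\}$, $p<q$, with $q<j$ (edges to the left of gap $j$). A Dyck path of semilength $n$ is a lattice path $(d_0,\dots,d_{2n})$ from $(0,0)$ to $(2n,0)$ with steps $(1,1)$ (up) and $(1,-1)$ (down) never below the $x$-axis; $\mathcal{D}(n)$ is their set. $dos(D)=(v_0,\dots,v_{2n})$ where $v_i$ is the number of down-steps among the first $i$ steps. A tunnel of $D$ (viewed as a broken line) is a horizontal segment at height $k+\tfrac12$, $k\in\mathbb{N}_0$, lying below $D$ and meeting $D$ only in its endpoints; one tunnel covers another if the projection of the latter to the $x$-axis is contained in that of the former. $ne(D)$ is the number of ordered pairs $(t_1,t_2)$ of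 distinct tunnels of $D$ with $t_1$ covering $t_2$. $F(M)$ is the Dyck path whose $k$-th step is up if $k$ is the smaller element of its edge in $M$ and down otherwise. -}

module Defs where

open import Data.Nat using (ℕ; zero; suc; _+_; _*_; _∸_; _≤_; _<_; _<ᵇ_; _≡ᵇ_)
open import Data.Bool using (Bool; true; false; _∧_; not; if_then_else_)
open import Data.Fin using (Fin; toℕ; _≟_)
import Data.Fin as Fin
open import Data.Vec using (Vec; lookup; tabulate)
open import Data.Product using (Σ; ∃; _×_; _,_; proj₁)
open import Relation.Nullary.Decidable using (⌊_⌋)
open import Relation.Binary.PropositionalEquality using (_≡_; _≢_; refl; sym; trans; isEquivalence)
open import Relation.Binary.Bundles using (Setoid)
open import Level using (0ℓ)

sumF : ∀ {m} → (Fin m → ℕ) → ℕ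
sumF {zero}  f = 0
sumF {suc m} f = f Fin.zero + sumF (λ k → f (Fin.suc k))

count : ∀ {m} → (Fin m → Bool) → ℕ
count f = sumF (λ k → if f k then 1 else 0)

count2 : ∀ {m} → (Fin m → Fin m → Bool) → ℕ
count2 f = sumF (λ a → count (f a))

count4 : ∀ {m} → (Fin m → Fin m → Fin m → Fin m → Bool) → ℕ
count4 f = sumF (λ a → sumF (λ b → count2 (f a b)))

allF : ∀ {m} → (Fin m → Bool) → Bool
allF {zero}  f = true
allF {suc m} f = f Fin.zero ∧ allF (λ k → f (Fin.suc k))

_<F_ : ∀ {m} → Fin m → Fin m → Bool
a <F b = toℕ a <ᵇ toℕ b

_≤F_ : ∀ {m} → Fin m → Fin m → Bool
a ≤F b = not (b <F a)

_==F_ : ∀ {m} → Fin m → Fin m → Bool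
a ==F b = ⌊ a ≟ b ⌋

-- The ground set [2n] is represented by Fin (2 * n)
-- (element x of [2n] is the Fin-element x-1).  A partition of [2n] into
-- two-element blocks is represented by its partner map: a fixed-point-free
-- involution, the blocks (edges) being {x , partner x}.

record Matching (n : ℕ) : Set where
  field
    partner : Fin (2 * n) → Fin (2 * n)
    involutive : ∀ x → partner (partner x) ≡ x
    fixpointFree : ∀ x → partner x ≢ x
open Matching public

-- ne(M): number of pairs of edges A , B with min A < min B < max B < max A.
-- An edge is listed via its smaller element a (a < partner a).
neM : ∀ {n} → Matching n → ℕ
neM M = count2 (λ a b →
  (a <F partner M a) ∧ (b <F partner M b) ∧
  (a <F b) ∧ (b <F partner M b) ∧ (partner M b <F partner M a))

-- nes(M): the j-th term (j = 1 .. 2n+1, stored at index j-1 : Fin (2n+1))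
-- is the number of edges {p , q}, p < q, with q < j (1-based), i.e. with
-- the 0-based larger element q' satisfying q' < j - 1.
nes : ∀ {n} → Matching n → Vec ℕ (suc (2 * n))
nes {n} M = tabulate (λ j → count2 (λ p q →
  (p <F q) ∧ (partner M p ==F q) ∧ (toℕ q <ᵇ toℕ j)))

-- Lattice paths given by their 2n steps (true = up step (1,1),
-- false = down step (1,-1)).

Steps : ℕ → Set
Steps n = Vec Bool (2 * n)

upsBefore : ∀ {n} → Steps n → ℕ → ℕ
upsBefore {n} s i = count (λ (k : Fin (2 * n)) → (toℕ k <ᵇ i) ∧ lookup s k)

downsBefore : ∀ {n} → Steps n → ℕ → ℕ
downsBefore {n} s i = count (λ (k : Fin (2 * n)) → (toℕ k <ᵇ i) ∧ not (lookup s k))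

-- height d_i of the path after i steps (meaningful when the path stays
-- weakly above the axis, as is the case for Dyck paths)
height : ∀ {n} → Steps n → ℕ → ℕ
height {n} s i = upsBefore {n} s i ∸ downsBefore {n} s i

IsDyck : ∀ {n} → Steps n → Set
IsDyck {n} s =
  (∀ (i : Fin (suc (2 * n))) → downsBefore {n} s (toℕ i) ≤ upsBefore {n} s (toℕ i))
  × upsBefore {n} s (2 * n) ≡ downsBefore {n} s (2 * n)

DyckPath : ℕ → Set
DyckPath n = Σ (Steps n) (IsDyck {n})

dos : ∀ {n} → Steps n → Vec ℕ (suc (2 * n))
dos {n} s = tabulate (λ i → downsBefore {n} s (toℕ i))

-- A tunnel at height k+1/2 has its endpoints at the midpoints of
-- an up step i (from height k to k+1) and a down step j (from k+1 to k),
-- i < j, and lies strictly below the path in between, i.e. d_m ≥ k+1 for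
-- i < m ≤ j.  It is identified with the pair (i , j) of step indices
-- (0-based); its projection to the x-axis is [i + 1/2 , j + 1/2].
isTunnel : ∀ {n} → Steps n → Fin (2 * n) → Fin (2 * n) → Bool
isTunnel {n} s i j =
  (i <F j) ∧ lookup s i ∧ not (lookup s j) ∧
  (height {n} s (toℕ i) ≡ᵇ height {n} s (suc (toℕ j))) ∧
  allF (λ (m : Fin (2 * n)) → not ((i <F m) ∧ (m ≤F j)) ∨' (height {n} s (toℕ i) <ᵇ height {n} s (toℕ m)))
  where
    _∨'_ : Bool → Bool → Bool
    true ∨' _ = true
    false ∨' b = b

-- ne(D): number of ordered pairs (t1 , t2) of distinct tunnels with t1
-- covering t2 (projection of t2 contained in projection of t1).
neD : ∀ {n} → Steps n → ℕ
neD {n} s = count4 (λ (i₁ j₁ i₂ j₂ : Fin (2 * n)) →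
  isTunnel {n} s i₁ j₁ ∧ isTunnel {n} s i₂ j₂ ∧
  not ((i₁ ==F i₂) ∧ (j₁ ==F j₂)) ∧
  (i₁ ≤F i₂) ∧ (j₂ ≤F j₁))

F : ∀ {n} → Matching n → Steps n
F {n} M = tabulate {n = 2 * n} (λ k → k <F partner M k)

NesSet : ℕ → Set
NesSet n = Σ (Vec ℕ (suc (2 * n))) (λ v → ∃ λ (M : Matching n) → nes M ≡ v)

NesSetoid : ℕ → Setoid 0ℓ 0ℓ
NesSetoid n = record
  { Carrier = NesSet n
  ; _≈_ = λ x y → proj₁ x ≡ proj₁ y
  ; isEquivalence = record { refl = refl ; sym = sym ; trans = trans } }

DyckSetoid : ℕ → Setoid 0ℓ 0ℓ
DyckSetoid n = record
  { Carrier = DyckPath n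
  ; _≈_ = λ x y → proj₁ x ≡ proj₁ y
  ; isEquivalence = record { refl = refl ; sym = sym ; trans = trans } }

-- Scanning a matching M from left to right, a step is up exactly when it opens an
-- edge, so the height of F M after t steps is the number of edges open across that
-- point; in particular F M is a Dyck path, and nes M = dos (F M) because both count
-- the edges already closed. Since dos determines the path, nes M and F M determine
-- each other, which gives the bijection.
--
-- For a Dyck path D, matching every step with the other end of its tunnel gives a
-- non-crossing matching M₀ with F M₀ = D whose nestings are exactly the pairs of
-- tunnels one covering the other, so ne M₀ = ne D. For any M with F M = D, a nesting
-- (a , b) is an edge a still open when b opens, so ne M is at most the sum of the
-- heights of D at its up steps; this bound depends on D only and is attained by the
-- non-crossing M₀. Conversely, if ne M > 0 there are two closers c < c′ with no closer
-- between them whose edges nest; exchanging c and c′ keeps F M and destroys exactly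
-- that nesting, so swaps starting from M₀ reach every value 0 , … , ne D.

module Submission where

open import Defs
open import Data.Bool using (Bool; true; false; _∧_; not; if_then_else_; T)
import Data.Bool.Properties as Boolₚ
open import Data.Bool.Properties using (∧-comm; ∧-identityʳ; ∧-zeroʳ; not-injective; T-≡; ⇔→≡)
open import Data.Empty using (⊥; ⊥-elim)
open import Data.Fin using (Fin; toℕ; _≟_; fromℕ<; inject₁)
import Data.Fin as Fin
import Data.Fin.Properties as Finₚ
open import Data.Nat as ℕ using (ℕ; zero; suc; _+_; _*_; _∸_; _≤_; _<_; _<ᵇ_; _≡ᵇ_; z≤n; s≤s; s≤s⁻¹; z<s)
open import Data.Nat.Properties hiding (_≟_)
open import Algebra.Properties.CommutativeSemigroup +-commutativeSemigroup using (interchange; x∙yz≈y∙xz; x∙yz≈yx∙z)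
open import Data.Product using (Σ; ∃; _×_; _,_; proj₁; proj₂)
open import Data.Sum using (_⊎_; inj₁; inj₂)
open import Data.Vec using (lookup)
open import Data.Vec.Properties using (lookup∘tabulate; tabulate-cong; tabulate∘lookup)
open import Data.Fin.Permutation.Components using (transpose)
open import Function using (_∘_)
open import Function.Bundles using (Bijection; Equivalence; mk⇔)
open import Relation.Binary.Definitions using (tri<; tri≈; tri>)
open import Relation.Binary.PropositionalEquality
open import Relation.Nullary using (¬_; yes; no; contradiction; _×-dec_)
open import Relation.Nullary.Decidable using (dec-true; dec-false)

-- Finite sums and counting

𝟙 : Bool → ℕ
𝟙 b = if b then 1 else 0

sumF-cong : ∀ {m} {f g : Fin m → ℕ} → (∀ k → f k ≡ g k) → sumF f ≡ sumF g
sumF-cong {zero}  f≗g = refl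
sumF-cong {suc m} f≗g = cong₂ _+_ (f≗g Fin.zero) (sumF-cong (f≗g ∘ Fin.suc))

sumF-+ : ∀ {m} (f g : Fin m → ℕ) → sumF (λ k → f k + g k) ≡ sumF f + sumF g
sumF-+ {zero}  f g = refl
sumF-+ {suc m} f g =
  trans (cong (f Fin.zero + g Fin.zero +_) (sumF-+ (f ∘ Fin.suc) (g ∘ Fin.suc)))
        (interchange (f Fin.zero) (g Fin.zero) _ _)

sumF-mono-≤ : ∀ {m} {f g : Fin m → ℕ} → (∀ k → f k ≤ g k) → sumF f ≤ sumF g
sumF-mono-≤ {zero}  f≤g = z≤n
sumF-mono-≤ {suc m} f≤g = +-mono-≤ (f≤g Fin.zero) (sumF-mono-≤ (f≤g ∘ Fin.suc))

sumF-zero : ∀ {m} {f : Fin m → ℕ} → (∀ k → f k ≡ 0) → sumF f ≡ 0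
sumF-zero {zero}  f≗0 = refl
sumF-zero {suc m} f≗0 = cong₂ _+_ (f≗0 Fin.zero) (sumF-zero (f≗0 ∘ Fin.suc))

sumF-comm : ∀ {p q} (f : Fin p → Fin q → ℕ) →
  sumF (λ a → sumF (λ b → f a b)) ≡ sumF (λ b → sumF (λ a → f a b))
sumF-comm {zero} {q} f = sym (sumF-zero {q} (λ _ → refl))
sumF-comm {suc p} f =
  trans (cong (sumF (f Fin.zero) +_) (sumF-comm (f ∘ Fin.suc)))
        (sym (sumF-+ (f Fin.zero) (λ b → sumF (λ a → f (Fin.suc a) b))))

sumF-single : ∀ {m} {f : Fin m → ℕ} (x : Fin m) → (∀ k → k ≢ x → f k ≡ 0) → sumF f ≡ f x
sumF-single {suc m} {f} Fin.zero f≗0 =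
  trans (cong (f Fin.zero +_) (sumF-zero (λ k → f≗0 (Fin.suc k) (λ ())))) (+-identityʳ _)
sumF-single {suc m} {f} (Fin.suc x) f≗0 =
  trans (cong (_+ sumF (f ∘ Fin.suc)) (f≗0 Fin.zero (λ ())))
        (sumF-single x (λ k k≢x → f≗0 (Fin.suc k) (k≢x ∘ Finₚ.suc-injective)))

sumF-pos⇒∃pos : ∀ {m} {f : Fin m → ℕ} → 0 < sumF f → ∃ λ k → 0 < f k
sumF-pos⇒∃pos {suc m} {f} pos with f Fin.zero in eq
... | suc _ = Fin.zero , subst (0 <_) (sym eq) z<s
... | zero with sumF-pos⇒∃pos {f = f ∘ Fin.suc} pos
...   | k , fk>0 = Fin.suc k , fk>0

𝟙-pos⇒true : ∀ {b} → 0 < 𝟙 b → b ≡ true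
𝟙-pos⇒true {true} _ = refl

𝟙-mono : ∀ {a b} → (a ≡ true → b ≡ true) → 𝟙 a ≤ 𝟙 b
𝟙-mono {false} a⇒b = z≤n
𝟙-mono {true}  a⇒b rewrite a⇒b refl = ≤-refl

count-∧ˡ : ∀ {m} (c : Bool) (g : Fin m → Bool) →
  sumF (λ a → 𝟙 (c ∧ g a)) ≡ (if c then count g else 0)
count-∧ˡ true  g = refl
count-∧ˡ {m} false g = sumF-zero {m} (λ _ → refl)

<⇒<ᵇ≡true : ∀ {m n} → m < n → (m <ᵇ n) ≡ true
<⇒<ᵇ≡true m<n = Equivalence.to T-≡ (<⇒<ᵇ m<n)

≤⇒<ᵇ≡false : ∀ {m n} → n ≤ m → (m <ᵇ n) ≡ false
≤⇒<ᵇ≡false {m} {n} n≤m with m <ᵇ n in eq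
... | false = refl
... | true  = ⊥-elim (≤⇒≯ n≤m (<ᵇ⇒< m n (subst T (sym eq) _)))

<ᵇ≡true⇒< : ∀ {m n} → (m <ᵇ n) ≡ true → m < n
<ᵇ≡true⇒< {m} {n} eq = <ᵇ⇒< m n (Equivalence.from T-≡ eq)

<ᵇ≡false⇒≥ : ∀ {m n} → (m <ᵇ n) ≡ false → n ≤ m
<ᵇ≡false⇒≥ eq = ≮⇒≥ (λ m<n → subst T eq (<⇒<ᵇ m<n))

not-<ᵇ≡true⇒≥ : ∀ {m n} → not (m <ᵇ n) ≡ true → n ≤ m
not-<ᵇ≡true⇒≥ eq = <ᵇ≡false⇒≥ (not-injective eq)

not-<ᵇ≡false⇒< : ∀ {m n} → not (m <ᵇ n) ≡ false → m < n
not-<ᵇ≡false⇒< eq = <ᵇ≡true⇒< (not-injective eq)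

==F-refl : ∀ {m} (a : Fin m) → (a ==F a) ≡ true
==F-refl a with a ≟ a
... | yes _   = refl
... | no  a≢a = ⊥-elim (a≢a refl)

≢⇒==F≡false : ∀ {m} {a b : Fin m} → a ≢ b → (a ==F b) ≡ false
≢⇒==F≡false {a = a} {b} a≢b with a ≟ b
... | yes a≡b = ⊥-elim (a≢b a≡b)
... | no  _   = refl

not-<F : ∀ {m} (a b : Fin m) → a ≢ b → not (a <F b) ≡ (b <F a)
not-<F a b a≢b with <-cmp (toℕ a) (toℕ b)
... | tri< a<b _ _ rewrite <⇒<ᵇ≡true a<b | ≤⇒<ᵇ≡false (<⇒≤ a<b) = refl
... | tri≈ _ a≡b _ = ⊥-elim (a≢b (Finₚ.toℕ-injective a≡b))
... | tri> _ _ a>b rewrite <⇒<ᵇ≡true a>b | ≤⇒<ᵇ≡false (<⇒≤ a>b) = refl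

∧-true : ∀ {a b} → a ≡ true → b ≡ true → (a ∧ b) ≡ true
∧-true refl refl = refl

∧-repeat : ∀ x y z w → (x ∧ (y ∧ (z ∧ w))) ≡ (x ∧ (y ∧ (z ∧ (y ∧ w))))
∧-repeat x true  z w = refl
∧-repeat x false z w = refl

true-or-false : ∀ b → b ≡ true ⊎ b ≡ false
true-or-false true  = inj₁ refl
true-or-false false = inj₂ refl

∧-true⁻¹ : ∀ {a b} → (a ∧ b) ≡ true → a ≡ true × b ≡ true
∧-true⁻¹ {true} b≡true = refl , b≡true

allF⇒∀ : ∀ {m} {g : Fin m → Bool} → allF g ≡ true → ∀ k → g k ≡ true
allF⇒∀ {suc m} all Fin.zero    = proj₁ (∧-true⁻¹ all)
allF⇒∀ {suc m} all (Fin.suc k) = allF⇒∀ (proj₂ (∧-true⁻¹ all)) k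

∀⇒allF : ∀ {m} {g : Fin m → Bool} → (∀ k → g k ≡ true) → allF g ≡ true
∀⇒allF {zero}  all = refl
∀⇒allF {suc m} all = ∧-true (all Fin.zero) (∀⇒allF (all ∘ Fin.suc))

<ᵇ-suc-≢ : ∀ {x t} → x ≢ t → (x <ᵇ suc t) ≡ (x <ᵇ t)
<ᵇ-suc-≢ {x} {t} x≢t with <-cmp x t
... | tri< x<t _ _ rewrite <⇒<ᵇ≡true x<t | <⇒<ᵇ≡true (m<n⇒m<1+n x<t) = refl
... | tri≈ _ x≡t _ = ⊥-elim (x≢t x≡t)
... | tri> _ _ x>t rewrite ≤⇒<ᵇ≡false (<⇒≤ x>t) | ≤⇒<ᵇ≡false x>t = refl

<ᵇ-suc-self : ∀ t → (t <ᵇ suc t) ≡ true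
<ᵇ-suc-self t = <⇒<ᵇ≡true {t} (n<1+n t)

<ᵇ-self : ∀ t → (t <ᵇ t) ≡ false
<ᵇ-self t = ≤⇒<ᵇ≡false {t} ≤-refl

count-single : ∀ {m} (x : Fin m) (c : Bool) → sumF (λ k → 𝟙 (c ∧ (k ==F x))) ≡ 𝟙 c
count-single x c =
  trans (sumF-single x off) (cong 𝟙 (trans (cong (c ∧_) (==F-refl x)) (∧-identityʳ c)))
  where
  off : ∀ k → k ≢ x → 𝟙 (c ∧ (k ==F x)) ≡ 0
  off k k≢x rewrite ≢⇒==F≡false k≢x | ∧-zeroʳ c = refl

count-prefix-suc : ∀ {N} (b : Fin N → Bool) (t : Fin N) →
  count (λ k → (toℕ k <ᵇ suc (toℕ t)) ∧ b k) ≡ count (λ k → (toℕ k <ᵇ toℕ t) ∧ b k) + 𝟙 (b t)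
count-prefix-suc b t = begin
    sumF (λ k → 𝟙 ((toℕ k <ᵇ suc (toℕ t)) ∧ b k))
  ≡⟨ sumF-cong split ⟩
    sumF (λ k → 𝟙 ((toℕ k <ᵇ toℕ t) ∧ b k) + 𝟙 (b t ∧ (k ==F t)))
  ≡⟨ sumF-+ (λ k → 𝟙 ((toℕ k <ᵇ toℕ t) ∧ b k)) (λ k → 𝟙 (b t ∧ (k ==F t))) ⟩
    count (λ k → (toℕ k <ᵇ toℕ t) ∧ b k) + sumF (λ k → 𝟙 (b t ∧ (k ==F t)))
  ≡⟨ cong (count (λ k → (toℕ k <ᵇ toℕ t) ∧ b k) +_) (count-single t (b t)) ⟩
    count (λ k → (toℕ k <ᵇ toℕ t) ∧ b k) + 𝟙 (b t)
  ∎
  where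
  open ≡-Reasoning
  split : ∀ k → 𝟙 ((toℕ k <ᵇ suc (toℕ t)) ∧ b k) ≡ 𝟙 ((toℕ k <ᵇ toℕ t) ∧ b k) + 𝟙 (b t ∧ (k ==F t))
  split k with k ≟ t
  ... | yes refl rewrite <ᵇ-suc-self (toℕ k) | <ᵇ-self (toℕ k) | ∧-identityʳ (b k) = refl
  ... | no k≢t rewrite <ᵇ-suc-≢ (k≢t ∘ Finₚ.toℕ-injective) | ∧-zeroʳ (b t) = sym (+-identityʳ _)

count-prefix-zero : ∀ {N} (b : Fin N → Bool) → count (λ k → (toℕ k <ᵇ 0) ∧ b k) ≡ 0
count-prefix-zero {N} b = sumF-zero {N} (λ _ → refl)

prefix-induction : ∀ {N} (Q : ℕ → Set) → Q 0 →
  (∀ (τ : Fin N) → Q (toℕ τ) → Q (suc (toℕ τ))) → ∀ t → t ≤ N → Q t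
prefix-induction Q q₀ step zero    _   = q₀
prefix-induction Q q₀ step (suc t) t<N =
  subst (Q ∘ suc) (Finₚ.toℕ-fromℕ< t<N)
    (step (fromℕ< t<N) (subst Q (sym (Finₚ.toℕ-fromℕ< t<N)) (prefix-induction Q q₀ step t (<⇒≤ t<N))))

upStepHeights : ∀ {n} → Steps n → ℕ
upStepHeights {n} s = sumF (λ b → if lookup s b then height {n} s (toℕ b) else 0)

-- Matchings

module MatchingProperties {n : ℕ} (M : Matching n) where

  P : Fin (2 * n) → Fin (2 * n)
  P = partner M

  partner-injective : ∀ {a b} → P a ≡ P b → a ≡ b
  partner-injective {a} {b} eq = trans (sym (involutive M a)) (trans (cong P eq) (involutive M b))

  partner-swap : ∀ {a b} → P a ≡ b → a ≡ P b
  partner-swap {a} eq = trans (sym (involutive M a)) (cong P eq)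

  opens : Fin (2 * n) → Bool
  opens a = a <F P a

  not-opens : ∀ a → not (opens a) ≡ (P a <F a)
  not-opens a = not-<F a (P a) (fixpointFree M a ∘ sym)

  opens-partner : ∀ a → opens (P a) ≡ not (opens a)
  opens-partner a = trans (cong (P a <F_) (involutive M a)) (sym (not-opens a))

  partner-of-opener-closes : ∀ {a} → opens a ≡ true → opens (P a) ≡ false
  partner-of-opener-closes a-opens = trans (opens-partner _) (cong not a-opens)

  partner-of-closer-opens : ∀ {a} → opens a ≡ false → opens (P a) ≡ true
  partner-of-closer-opens a-closes = trans (opens-partner _) (cong not a-closes)

  opener≢closer : ∀ {a b} → opens a ≡ true → opens b ≡ false → a ≢ b
  opener≢closer a-opens b-closes refl = contradiction (trans (sym a-opens) b-closes) λ ()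

  lookup-F : ∀ k → lookup (F M) k ≡ opens k
  lookup-F = lookup∘tabulate {n = 2 * n} opens

  -- Each closer q is counted in nes once, through its unique partner p = P q.
  nes≡dos∘F : nes M ≡ dos {n} (F M)
  nes≡dos∘F = tabulate-cong λ j → begin
      sumF (λ p → sumF (λ q → 𝟙 (closedBefore j p q)))
    ≡⟨ sumF-comm (λ p q → 𝟙 (closedBefore j p q)) ⟩
      sumF (λ q → sumF (λ p → 𝟙 (closedBefore j p q)))
    ≡⟨ sumF-cong (λ q → sumF-single (P q) (off j q)) ⟩
      sumF (λ q → 𝟙 (closedBefore j (P q) q))
    ≡⟨ sumF-cong (λ q → cong 𝟙 (at j q)) ⟩
      sumF (λ q → 𝟙 ((toℕ q <ᵇ toℕ j) ∧ not (lookup (F M) q)))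
    ∎
    where
    open ≡-Reasoning
    closedBefore : Fin (suc (2 * n)) → Fin (2 * n) → Fin (2 * n) → Bool
    closedBefore j p q = (p <F q) ∧ (P p ==F q) ∧ (toℕ q <ᵇ toℕ j)
    off : ∀ j q p → p ≢ P q → 𝟙 (closedBefore j p q) ≡ 0
    off j q p p≢Pq rewrite ≢⇒==F≡false {a = P p} {b = q} (p≢Pq ∘ partner-swap)
                         | ∧-zeroʳ (p <F q) = refl
    at : ∀ j q → closedBefore j (P q) q ≡ ((toℕ q <ᵇ toℕ j) ∧ not (lookup (F M) q))
    at j q rewrite involutive M q | ==F-refl q | lookup-F q | not-opens q =
      ∧-comm (P q <F q) (toℕ q <ᵇ toℕ j)

  edge : Fin (2 * n) → Fin (2 * n) → Bool
  edge a b = opens a ∧ (P a ==F b)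

  covers : Fin (2 * n) → Fin (2 * n) → Fin (2 * n) → Fin (2 * n) → Bool
  covers a b c d = edge a b ∧ edge c d ∧ not ((a ==F c) ∧ (b ==F d)) ∧ (a ≤F c) ∧ (d ≤F b)

  nests : Fin (2 * n) → Fin (2 * n) → Bool
  nests a c = (a <F P a) ∧ (c <F P c) ∧ (a <F c) ∧ (c <F P c) ∧ (P c <F P a)

  covers≡nests : ∀ a c → covers a (P a) c (P c) ≡ nests a c
  covers≡nests a c rewrite ==F-refl (P a) | ==F-refl (P c) | ∧-identityʳ (opens a) | ∧-identityʳ (opens c)
    with a ≟ c
  ... | yes refl rewrite ==F-refl (P a) | <ᵇ-self (toℕ a) = refl
  ... | no a≢c rewrite not-<F c a (a≢c ∘ sym) | not-<F (P a) (P c) (a≢c ∘ partner-injective) =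
    ∧-repeat (opens a) (opens c) (a <F c) (P c <F P a)

  count-covers≡neM : count4 covers ≡ neM M
  count-covers≡neM = begin
      count4 covers
    ≡⟨ sumF-cong (λ a → sumF-cong (λ b → sumF-cong (λ c → sumF-single (P c) (no-edge-cd a b c)))) ⟩
      sumF (λ a → sumF (λ b → sumF (λ c → 𝟙 (covers a b c (P c)))))
    ≡⟨ sumF-cong (λ a → sumF-single (P a) (λ b b≢Pa → sumF-zero (no-edge-ab a b b≢Pa))) ⟩
      sumF (λ a → sumF (λ c → 𝟙 (covers a (P a) c (P c))))
    ≡⟨ sumF-cong (λ a → sumF-cong (λ c → cong 𝟙 (covers≡nests a c))) ⟩
      neM M
    ∎
    where
    open ≡-Reasoning
    no-edge-cd : ∀ a b c d → d ≢ P c → 𝟙 (covers a b c d) ≡ 0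
    no-edge-cd a b c d d≢Pc rewrite ≢⇒==F≡false (d≢Pc ∘ sym) | ∧-zeroʳ (opens c) | ∧-zeroʳ (edge a b) = refl
    no-edge-ab : ∀ a b → b ≢ P a → ∀ c → 𝟙 (covers a b c (P c)) ≡ 0
    no-edge-ab a b b≢Pa c rewrite ≢⇒==F≡false (b≢Pa ∘ sym) | ∧-zeroʳ (opens a) = refl

  isOpenAt : ℕ → Fin (2 * n) → Bool
  isOpenAt t a = opens a ∧ (toℕ a <ᵇ t) ∧ not (toℕ (P a) <ᵇ t)

  openAt : ℕ → ℕ
  openAt t = count (isOpenAt t)

  openAt-zero : openAt 0 ≡ 0
  openAt-zero = sumF-zero (λ a → cong 𝟙 (∧-zeroʳ (opens a)))

  openAt-end : openAt (2 * n) ≡ 0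
  openAt-end = sumF-zero λ a → cong 𝟙 (begin
      opens a ∧ (toℕ a <ᵇ 2 * n) ∧ not (toℕ (P a) <ᵇ 2 * n)
    ≡⟨ cong (λ b → opens a ∧ (toℕ a <ᵇ 2 * n) ∧ not b) (<⇒<ᵇ≡true (Finₚ.toℕ<n (P a))) ⟩
      opens a ∧ (toℕ a <ᵇ 2 * n) ∧ false
    ≡⟨ cong (opens a ∧_) (∧-zeroʳ (toℕ a <ᵇ 2 * n)) ⟩
      opens a ∧ false
    ≡⟨ ∧-zeroʳ (opens a) ⟩
      false
    ∎)
    where open ≡-Reasoning

  openAt-suc-pointwise : ∀ (t a : Fin (2 * n)) →
    𝟙 (isOpenAt (suc (toℕ t)) a) + 𝟙 (not (opens t) ∧ (a ==F P t))
      ≡ 𝟙 (isOpenAt (toℕ t) a) + 𝟙 (opens t ∧ (a ==F t))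
  openAt-suc-pointwise t a with a ≟ t
  ... | yes refl rewrite <ᵇ-suc-self (toℕ a) | <ᵇ-self (toℕ a) | ∧-identityʳ (opens a)
      with opens a in opens-a
  ...   | false rewrite ≢⇒==F≡false {a = a} {b = P a} (fixpointFree M a ∘ sym) = refl
  ...   | true  rewrite ≤⇒<ᵇ≡false {toℕ (P a)} {suc (toℕ a)} (<ᵇ≡true⇒< opens-a) = refl
  openAt-suc-pointwise t a | no a≢t
    rewrite <ᵇ-suc-≢ (a≢t ∘ Finₚ.toℕ-injective) | ∧-zeroʳ (opens t)
    with a ≟ P t
  ... | yes refl rewrite involutive M t | <ᵇ-suc-self (toℕ t) | <ᵇ-self (toℕ t)
      with toℕ (P t) <ᵇ toℕ t in Pt<t
  ...   | false rewrite <⇒<ᵇ≡true (≤∧≢⇒< (<ᵇ≡false⇒≥ Pt<t) (fixpointFree M t ∘ Finₚ.toℕ-injective ∘ sym)) = refl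
  ...   | true  rewrite ≤⇒<ᵇ≡false {toℕ t} (<⇒≤ (<ᵇ≡true⇒< Pt<t)) = refl
  openAt-suc-pointwise t a | no a≢t | no a≢Pt
    rewrite ∧-zeroʳ (not (opens t))
          | <ᵇ-suc-≢ {toℕ (P a)} {toℕ t} (a≢Pt ∘ partner-swap ∘ Finₚ.toℕ-injective) = refl

  openAt-suc : ∀ (t : Fin (2 * n)) →
    openAt (suc (toℕ t)) + 𝟙 (not (opens t)) ≡ openAt (toℕ t) + 𝟙 (opens t)
  openAt-suc t = begin
      openAt (suc (toℕ t)) + 𝟙 (not (opens t))
    ≡⟨ cong (openAt (suc (toℕ t)) +_) (sym (count-single (P t) (not (opens t)))) ⟩
      openAt (suc (toℕ t)) + sumF (λ a → 𝟙 (not (opens t) ∧ (a ==F P t)))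
    ≡⟨ sym (sumF-+ (𝟙 ∘ isOpenAt (suc (toℕ t))) (λ a → 𝟙 (not (opens t) ∧ (a ==F P t)))) ⟩
      sumF (λ a → 𝟙 (isOpenAt (suc (toℕ t)) a) + 𝟙 (not (opens t) ∧ (a ==F P t)))
    ≡⟨ sumF-cong (openAt-suc-pointwise t) ⟩
      sumF (λ a → 𝟙 (isOpenAt (toℕ t) a) + 𝟙 (opens t ∧ (a ==F t)))
    ≡⟨ sumF-+ (𝟙 ∘ isOpenAt (toℕ t)) (λ a → 𝟙 (opens t ∧ (a ==F t))) ⟩
      openAt (toℕ t) + sumF (λ a → 𝟙 (opens t ∧ (a ==F t)))
    ≡⟨ cong (openAt (toℕ t) +_) (count-single t (opens t)) ⟩
      openAt (toℕ t) + 𝟙 (opens t)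
    ∎
    where open ≡-Reasoning

  openAt+downs≡ups : ∀ t → t ≤ 2 * n → openAt t + downsBefore {n} (F M) t ≡ upsBefore {n} (F M) t
  openAt+downs≡ups = prefix-induction Balanced base step
    where
    Balanced : ℕ → Set
    Balanced t = openAt t + downsBefore {n} (F M) t ≡ upsBefore {n} (F M) t
    base : Balanced 0
    base = trans (cong₂ _+_ openAt-zero (count-prefix-zero (not ∘ lookup (F M))))
                 (sym (count-prefix-zero (lookup (F M))))
    step : ∀ (τ : Fin (2 * n)) → Balanced (toℕ τ) → Balanced (suc (toℕ τ))
    step τ ih = begin
        openAt (suc (toℕ τ)) + downsBefore {n} (F M) (suc (toℕ τ))
      ≡⟨ cong (openAt (suc (toℕ τ)) +_) (count-prefix-suc (not ∘ lookup (F M)) τ) ⟩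
        openAt (suc (toℕ τ)) + (d + 𝟙 (not (lookup (F M) τ)))
      ≡⟨ x∙yz≈y∙xz (openAt (suc (toℕ τ))) d _ ⟩
        d + (openAt (suc (toℕ τ)) + 𝟙 (not (lookup (F M) τ)))
      ≡⟨ cong (d +_) (trans (cong (λ b → openAt (suc (toℕ τ)) + 𝟙 (not b)) (lookup-F τ)) (openAt-suc τ)) ⟩
        d + (openAt (toℕ τ) + 𝟙 (opens τ))
      ≡⟨ x∙yz≈yx∙z d (openAt (toℕ τ)) _ ⟩
        (openAt (toℕ τ) + d) + 𝟙 (opens τ)
      ≡⟨ cong₂ _+_ ih (cong 𝟙 (sym (lookup-F τ))) ⟩
        upsBefore {n} (F M) (toℕ τ) + 𝟙 (lookup (F M) τ)
      ≡⟨ count-prefix-suc (lookup (F M)) τ ⟨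
        upsBefore {n} (F M) (suc (toℕ τ))
      ∎
      where
      open ≡-Reasoning
      d = downsBefore {n} (F M) (toℕ τ)

  F-isDyck : IsDyck {n} (F M)
  F-isDyck = (λ i → subst (downsBefore {n} (F M) (toℕ i) ≤_)
                          (openAt+downs≡ups (toℕ i) (Finₚ.toℕ≤pred[n] i)) (m≤n+m _ _))
           , trans (sym (openAt+downs≡ups (2 * n) ≤-refl)) (cong (_+ downsBefore {n} (F M) (2 * n)) openAt-end)

  openAt≡height : ∀ t → t ≤ 2 * n → openAt t ≡ height {n} (F M) t
  openAt≡height t t≤2n =
    sym (trans (cong (_∸ downsBefore {n} (F M) t) (sym (openAt+downs≡ups t t≤2n)))
               (m+n∸n≡m (openAt t) (downsBefore {n} (F M) t)))

  openerDepths : ℕ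
  openerDepths = sumF (λ b → if opens b then openAt (toℕ b) else 0)

  openerDepths≡upStepHeights : openerDepths ≡ upStepHeights {n} (F M)
  openerDepths≡upStepHeights = sumF-cong λ b →
    trans (cong (λ x → if x then openAt (toℕ b) else 0) (sym (lookup-F b)))
          (cong (λ h → if lookup (F M) b then h else 0) (openAt≡height (toℕ b) (<⇒≤ (Finₚ.toℕ<n b))))

  nests⇒openAt : ∀ a b → nests a b ≡ true → (opens b ∧ isOpenAt (toℕ b) a) ≡ true
  nests⇒openAt a b nest =
    ∧-true b-opens (∧-true a-opens (∧-true a<b (cong not (≤⇒<ᵇ≡false {toℕ (P a)} (<⇒≤ b<Pa)))))
    where
    c₁ = ∧-true⁻¹ {opens a} nest
    a-opens = proj₁ c₁
    c₂ = ∧-true⁻¹ {opens b} (proj₂ c₁)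
    b-opens = proj₁ c₂
    c₃ = ∧-true⁻¹ {a <F b} (proj₂ c₂)
    a<b = proj₁ c₃
    b<Pa : toℕ b < toℕ (P a)
    b<Pa = <-trans (<ᵇ≡true⇒< {toℕ b} b-opens)
                   (<ᵇ≡true⇒< {toℕ (P b)} (proj₂ (∧-true⁻¹ {opens b} (proj₂ c₃))))

  neM≤openerDepths : neM M ≤ openerDepths
  neM≤openerDepths = begin
      neM M
    ≡⟨ sumF-comm (λ a b → 𝟙 (nests a b)) ⟩
      sumF (λ b → sumF (λ a → 𝟙 (nests a b)))
    ≤⟨ sumF-mono-≤ (λ b → sumF-mono-≤ (λ a → 𝟙-mono (nests⇒openAt a b))) ⟩
      sumF (λ b → sumF (λ a → 𝟙 (opens b ∧ isOpenAt (toℕ b) a)))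
    ≡⟨ sumF-cong (λ b → count-∧ˡ (opens b) (isOpenAt (toℕ b))) ⟩
      openerDepths
    ∎
    where open ≤-Reasoning

  NonCrossing : Set
  NonCrossing = ∀ a b → opens a ≡ true → opens b ≡ true →
    toℕ a < toℕ b → toℕ b < toℕ (P a) → toℕ (P b) < toℕ (P a)

  openAt⇒nests : NonCrossing → ∀ a b → (opens b ∧ isOpenAt (toℕ b) a) ≡ true → nests a b ≡ true
  openAt⇒nests non-crossing a b open-at-b =
    ∧-true a-opens (∧-true b-opens (∧-true a<b (∧-true b-opens
      (<⇒<ᵇ≡true (non-crossing a b a-opens b-opens (<ᵇ≡true⇒< a<b) b<Pa)))))
    where
    c₁ = ∧-true⁻¹ {opens b} open-at-b
    b-opens = proj₁ c₁
    c₂ = ∧-true⁻¹ {opens a} (proj₂ c₁)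
    a-opens = proj₁ c₂
    c₃ = ∧-true⁻¹ {a <F b} (proj₂ c₂)
    a<b = proj₁ c₃
    b<Pa : toℕ b < toℕ (P a)
    b<Pa = ≤∧≢⇒< (not-<ᵇ≡true⇒≥ (proj₂ c₃))
                 (opener≢closer b-opens (partner-of-opener-closes a-opens) ∘ Finₚ.toℕ-injective)

  neM≡openerDepths : NonCrossing → neM M ≡ openerDepths
  neM≡openerDepths non-crossing =
    trans (sumF-comm (λ a b → 𝟙 (nests a b)))
          (sumF-cong λ b → trans (sumF-cong λ a → cong 𝟙 (⇔→≡ {z = true}
                                    (mk⇔ (nests⇒openAt a b) (openAt⇒nests non-crossing a b))))
                                 (count-∧ˡ (opens b) (isOpenAt (toℕ b))))

-- Bounded searches

record LeastIn (Q : ℕ → Bool) (lo hi : ℕ) : Set where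
  field
    value    : ℕ
    lo≤value : lo ≤ value
    value≤hi : value ≤ hi
    holds    : Q value ≡ true
    minimal  : ∀ k → lo ≤ k → k < value → Q k ≡ false

least : (Q : ℕ → Bool) (lo d : ℕ) → Q (lo + d) ≡ true → LeastIn Q lo (lo + d)
least Q lo d Q-end with Q lo in Q-lo
... | true = record
  { value = lo ; lo≤value = ≤-refl ; value≤hi = m≤m+n lo d ; holds = Q-lo
  ; minimal = λ k lo≤k k<lo → contradiction lo≤k (<⇒≱ k<lo) }
least Q lo zero Q-end | false =
  contradiction (trans (sym Q-lo) (subst (λ m → Q m ≡ true) (+-identityʳ lo) Q-end)) λ ()
least Q lo (suc d) Q-end | false = record
  { value = value ; lo≤value = <⇒≤ lo<value
  ; value≤hi = subst (value ≤_) (sym (+-suc lo d)) value≤hi ; holds = holds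
  ; minimal = minimal′ }
  where
  open LeastIn (least Q (suc lo) d (subst (λ m → Q m ≡ true) (+-suc lo d) Q-end))
    renaming (lo≤value to lo<value)
  minimal′ : ∀ k → lo ≤ k → k < value → Q k ≡ false
  minimal′ k lo≤k k<value with lo ℕ.≟ k
  ... | yes refl = Q-lo
  ... | no lo≢k  = minimal k (≤∧≢⇒< lo≤k lo≢k) k<value

record GreatestIn (Q : ℕ → Bool) (lo hi : ℕ) : Set where
  field
    value    : ℕ
    lo≤value : lo ≤ value
    value≤hi : value ≤ hi
    holds    : Q value ≡ true
    maximal  : ∀ k → value < k → k ≤ hi → Q k ≡ false

greatest : (Q : ℕ → Bool) (lo d : ℕ) → Q lo ≡ true → GreatestIn Q lo (lo + d)
greatest Q lo d Q-lo with Q (lo + d) in Q-end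
... | true = record
  { value = lo + d ; lo≤value = m≤m+n lo d ; value≤hi = ≤-refl ; holds = Q-end
  ; maximal = λ k hi<k k≤hi → contradiction k≤hi (<⇒≱ hi<k) }
greatest Q lo zero Q-lo | false =
  contradiction (trans (sym (subst (λ m → Q m ≡ true) (sym (+-identityʳ lo)) Q-lo)) Q-end) λ ()
greatest Q lo (suc d) Q-lo | false = record
  { value = value ; lo≤value = lo≤value
  ; value≤hi = ≤-trans value≤hi (≤-trans (n≤1+n _) (≤-reflexive (sym (+-suc lo d))))
  ; holds = holds ; maximal = maximal′ }
  where
  open GreatestIn (greatest Q lo d Q-lo)
  maximal′ : ∀ k → value < k → k ≤ lo + suc d → Q k ≡ false
  maximal′ k value<k k≤hi with k ℕ.≟ lo + suc d
  ... | yes refl = Q-end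
  ... | no k≢hi  = maximal k value<k (s≤s⁻¹ (subst (k <_) (+-suc lo d) (≤∧≢⇒< k≤hi k≢hi)))

-- Step sequences and Dyck paths

𝟙-not-injective : ∀ {a b} → 𝟙 (not a) ≡ 𝟙 (not b) → a ≡ b
𝟙-not-injective {true}  {true}  _ = refl
𝟙-not-injective {false} {false} _ = refl

dos-injective : ∀ {n} (s s′ : Steps n) → dos {n} s ≡ dos {n} s′ → s ≡ s′
dos-injective {n} s s′ eq =
  trans (sym (tabulate∘lookup s)) (trans (tabulate-cong same-step) (tabulate∘lookup s′))
  where
  open ≡-Reasoning
  downs≡ : ∀ (i : Fin (suc (2 * n))) → downsBefore {n} s (toℕ i) ≡ downsBefore {n} s′ (toℕ i)
  downs≡ i = begin
      downsBefore {n} s (toℕ i)   ≡⟨ lookup∘tabulate (downsBefore {n} s ∘ toℕ) i ⟨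
      lookup (dos {n} s) i        ≡⟨ cong (λ v → lookup v i) eq ⟩
      lookup (dos {n} s′) i       ≡⟨ lookup∘tabulate (downsBefore {n} s′ ∘ toℕ) i ⟩
      downsBefore {n} s′ (toℕ i)  ∎
  downs≡-at : ∀ (k : Fin (2 * n)) → downsBefore {n} s (toℕ k) ≡ downsBefore {n} s′ (toℕ k)
  downs≡-at k = subst (λ t → downsBefore {n} s t ≡ downsBefore {n} s′ t)
                      (Finₚ.toℕ-inject₁ k) (downs≡ (inject₁ k))
  same-step : ∀ k → lookup s k ≡ lookup s′ k
  same-step k = 𝟙-not-injective (+-cancelˡ-≡ (downsBefore {n} s (toℕ k)) _ _ (begin
      downsBefore {n} s (toℕ k) + 𝟙 (not (lookup s k))    ≡⟨ count-prefix-suc (not ∘ lookup s) k ⟨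
      downsBefore {n} s (suc (toℕ k))                      ≡⟨ downs≡ (Fin.suc k) ⟩
      downsBefore {n} s′ (suc (toℕ k))                     ≡⟨ count-prefix-suc (not ∘ lookup s′) k ⟩
      downsBefore {n} s′ (toℕ k) + 𝟙 (not (lookup s′ k))  ≡⟨ cong (_+ _) (downs≡-at k) ⟨
      downsBefore {n} s (toℕ k) + 𝟙 (not (lookup s′ k))   ∎))

module DyckProperties {n : ℕ} (s : Steps n) (dyck : IsDyck {n} s) where

  N : ℕ
  N = 2 * n

  ups downs ht : ℕ → ℕ
  ups   = upsBefore {n} s
  downs = downsBefore {n} s
  ht    = height {n} s

  downs≤ups : ∀ t → t ≤ N → downs t ≤ ups t
  downs≤ups t t≤N =
    subst (λ m → downs m ≤ ups m) (Finₚ.toℕ-fromℕ< (s≤s t≤N)) (proj₁ dyck (fromℕ< (s≤s t≤N)))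

  height-up : ∀ (τ : Fin N) → lookup s τ ≡ true → ht (suc (toℕ τ)) ≡ suc (ht (toℕ τ))
  height-up τ up
    rewrite count-prefix-suc (lookup s) τ | count-prefix-suc (not ∘ lookup s) τ | up | +-identityʳ (downs (toℕ τ)) =
    trans (+-∸-comm 1 (downs≤ups (toℕ τ) (<⇒≤ (Finₚ.toℕ<n τ)))) (+-comm _ 1)

  height-down : ∀ (τ : Fin N) → lookup s τ ≡ false → suc (ht (suc (toℕ τ))) ≡ ht (toℕ τ)
  height-down τ down with downs≤ups (suc (toℕ τ)) (Finₚ.toℕ<n τ)
  ... | downs≤ups′
    rewrite count-prefix-suc (lookup s) τ | count-prefix-suc (not ∘ lookup s) τ | down
          | +-identityʳ (ups (toℕ τ)) | +-comm (downs (toℕ τ)) 1 =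
    sym (+-∸-assoc 1 downs≤ups′)

  height-zero : ht 0 ≡ 0
  height-zero = trans (cong (_∸ downs 0) (count-prefix-zero (lookup s))) (0∸n≡0 (downs 0))

  height-end : ht N ≡ 0
  height-end = trans (cong (_∸ downs N) (proj₂ dyck)) (n∸n≡0 (downs N))

  record Tunnel (i j : Fin N) : Set where
    field
      i<j   : toℕ i < toℕ j
      up    : lookup s i ≡ true
      down  : lookup s j ≡ false
      level : ht (toℕ i) ≡ ht (suc (toℕ j))
      under : ∀ m → toℕ i < m → m ≤ toℕ j → ht (toℕ i) < ht m
  open Tunnel

  Tunnel-uniqueʳ : ∀ {i j j′} → Tunnel i j → Tunnel i j′ → j ≡ j′
  Tunnel-uniqueʳ {i} {j} {j′} t t′ with <-cmp (toℕ j) (toℕ j′)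
  ... | tri< j<j′ _ _ = contradiction (level t)  (<⇒≢ (under t′ _ (m<n⇒m<1+n (i<j t))  j<j′))
  ... | tri≈ _ j≡j′ _ = Finₚ.toℕ-injective j≡j′
  ... | tri> _ _ j>j′ = contradiction (level t′) (<⇒≢ (under t  _ (m<n⇒m<1+n (i<j t′)) j>j′))

  Tunnel-uniqueˡ : ∀ {i i′ j} → Tunnel i j → Tunnel i′ j → i ≡ i′
  Tunnel-uniqueˡ {i} {i′} t t′ with <-cmp (toℕ i) (toℕ i′)
  ... | tri< i<i′ _ _ = contradiction (trans (level t) (sym (level t′))) (<⇒≢ (under t  _ i<i′ (<⇒≤ (i<j t′))))
  ... | tri≈ _ i≡i′ _ = Finₚ.toℕ-injective i≡i′
  ... | tri> _ _ i>i′ = contradiction (trans (level t′) (sym (level t))) (<⇒≢ (under t′ _ i>i′ (<⇒≤ (i<j t))))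

  atMost : ℕ → ℕ → Bool
  atMost h m = not (h <ᵇ ht m)

  tunnel-from-first-return : ∀ {i j : Fin N} {hi} → lookup s i ≡ true →
    (r : LeastIn (atMost (ht (toℕ i))) (suc (toℕ i)) hi) → suc (toℕ j) ≡ LeastIn.value r → Tunnel i j
  tunnel-from-first-return {i} {j} up record { lo≤value = i<j+1 ; holds = returns ; minimal = minimal } refl =
    record { i<j = starts-before ; up = up ; down = ends-down ; level = same-level ; under = stays-above }
    where
    h = ht (toℕ i)
    ends-low : ht (suc (toℕ j)) ≤ h
    ends-low = not-<ᵇ≡true⇒≥ returns
    starts-before : toℕ i < toℕ j
    starts-before = ≤∧≢⇒< (s≤s⁻¹ i<j+1) λ i≡j →
      1+n≰n (subst (_≤ h) (height-up i up) (subst (λ m → ht (suc m) ≤ h) (sym i≡j) ends-low))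
    stays-above : ∀ m → toℕ i < m → m ≤ toℕ j → h < ht m
    stays-above m i<m m≤j = not-<ᵇ≡false⇒< (minimal m i<m (s≤s m≤j))
    ends-down : lookup s j ≡ false
    ends-down with lookup s j in step
    ... | false = refl
    ... | true  = contradiction (subst (h <_) (sym (height-up j step)) (m<n⇒m<1+n (stays-above _ starts-before ≤-refl)))
                                (≤⇒≯ ends-low)
    same-level : h ≡ ht (suc (toℕ j))
    same-level = ≤-antisym (s≤s⁻¹ (subst (h <_) (sym (height-down j ends-down)) (stays-above _ starts-before ≤-refl)))
                           ends-low

  tunnel-from-last-departure : ∀ {i j : Fin N} → lookup s j ≡ false →
    (r : GreatestIn (atMost (ht (suc (toℕ j)))) 0 (toℕ j)) → toℕ i ≡ GreatestIn.value r → Tunnel i j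
  tunnel-from-last-departure {i} {j} down record { value≤hi = i≤j ; holds = departs ; maximal = maximal } refl =
    record { i<j = starts-before ; up = starts-up ; down = down ; level = same-level ; under = stays-above }
    where
    h = ht (suc (toℕ j))
    starts-low : ht (toℕ i) ≤ h
    starts-low = not-<ᵇ≡true⇒≥ departs
    starts-before : toℕ i < toℕ j
    starts-before = ≤∧≢⇒< i≤j λ i≡j →
      1+n≰n (subst (_≤ h) (sym (height-down j down)) (subst (λ m → ht m ≤ h) i≡j starts-low))
    rises-after : h < ht (suc (toℕ i))
    rises-after = not-<ᵇ≡false⇒< (maximal _ ≤-refl starts-before)
    starts-up : lookup s i ≡ true
    starts-up with lookup s i in step
    ... | true  = refl
    ... | false = contradiction (<-≤-trans (subst (ht (suc (toℕ i)) <_) (height-down i step) (n<1+n _)) starts-low)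
                                (<-asym rises-after)
    same-level : ht (toℕ i) ≡ h
    same-level = ≤-antisym starts-low (s≤s⁻¹ (subst (h <_) (height-up i starts-up) rises-after))
    stays-above : ∀ m → toℕ i < m → m ≤ toℕ j → ht (toℕ i) < ht m
    stays-above m i<m m≤j = subst (_< ht m) (sym same-level) (not-<ᵇ≡false⇒< (maximal m i<m m≤j))

  -- Abstract: the searches are only needed through closerOf-tunnel and openerOf-tunnel,
  -- and letting Agda unfold them makes type checking very slow.
  abstract
    closingSearch : (i : Fin N) → LeastIn (atMost (ht (toℕ i))) (suc (toℕ i)) (suc (toℕ i) + (N ∸ suc (toℕ i)))
    closingSearch i = least _ _ _
      (subst (λ m → atMost (ht (toℕ i)) m ≡ true) (sym (m+[n∸m]≡n (Finₚ.toℕ<n i)))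
             (cong (λ x → not (ht (toℕ i) <ᵇ x)) height-end))

    closer<N : ∀ i → ℕ.pred (LeastIn.value (closingSearch i)) < N
    closer<N i with closingSearch i
    ... | record { value = suc v ; value≤hi = v<hi } = subst (v <_) (m+[n∸m]≡n (Finₚ.toℕ<n i)) v<hi

    closerOf : Fin N → Fin N
    closerOf i = fromℕ< (closer<N i)

    closerOf-tunnel : ∀ i → lookup s i ≡ true → Tunnel i (closerOf i)
    closerOf-tunnel i up = tunnel-from-first-return up (closingSearch i)
      (trans (cong suc (Finₚ.toℕ-fromℕ< (closer<N i))) (suc-pred _ {{ℕ.>-nonZero (<-≤-trans z<s lo≤value)}}))
      where open LeastIn (closingSearch i)

    openingSearch : (j : Fin N) → GreatestIn (atMost (ht (suc (toℕ j)))) 0 (toℕ j)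
    openingSearch j = greatest _ 0 (toℕ j) (cong (λ x → not (ht (suc (toℕ j)) <ᵇ x)) height-zero)

    opener<N : ∀ j → GreatestIn.value (openingSearch j) < N
    opener<N j = ≤-<-trans (GreatestIn.value≤hi (openingSearch j)) (Finₚ.toℕ<n j)

    openerOf : Fin N → Fin N
    openerOf j = fromℕ< (opener<N j)

    openerOf-tunnel : ∀ j → lookup s j ≡ false → Tunnel (openerOf j) j
    openerOf-tunnel j down = tunnel-from-last-departure down (openingSearch j) (Finₚ.toℕ-fromℕ< (opener<N j))

  -- The tunnel matching: every step is matched with the other end of its tunnel.
  partner₀ : Fin N → Fin N
  partner₀ x = if lookup s x then closerOf x else openerOf x

  partner₀-up : ∀ x → lookup s x ≡ true → Tunnel x (partner₀ x)
  partner₀-up x up rewrite up = closerOf-tunnel x up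

  partner₀-down : ∀ x → lookup s x ≡ false → Tunnel (partner₀ x) x
  partner₀-down x down rewrite down = openerOf-tunnel x down

  partner₀-involutive : ∀ x → partner₀ (partner₀ x) ≡ x
  partner₀-involutive x with true-or-false (lookup s x)
  ... | inj₁ step = sym (Tunnel-uniqueˡ (partner₀-up x step) (partner₀-down (partner₀ x) (down (partner₀-up x step))))
  ... | inj₂ step = sym (Tunnel-uniqueʳ (partner₀-down x step) (partner₀-up (partner₀ x) (up (partner₀-down x step))))

  partner₀-fixpointFree : ∀ x → partner₀ x ≢ x
  partner₀-fixpointFree x P₀x≡x with true-or-false (lookup s x)
  ... | inj₁ step = <-irrefl (cong toℕ (sym P₀x≡x)) (i<j (partner₀-up x step))
  ... | inj₂ step = <-irrefl (cong toℕ P₀x≡x) (i<j (partner₀-down x step))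

  tunnelMatching : Matching n
  tunnelMatching = record
    { partner = partner₀ ; involutive = partner₀-involutive ; fixpointFree = partner₀-fixpointFree }

  opens₀ : ∀ x → (x <F partner₀ x) ≡ lookup s x
  opens₀ x with true-or-false (lookup s x)
  ... | inj₁ step = trans (<⇒<ᵇ≡true (i<j (partner₀-up x step))) (sym step)
  ... | inj₂ step = trans (≤⇒<ᵇ≡false (<⇒≤ (i<j (partner₀-down x step)))) (sym step)

  F-tunnelMatching : F tunnelMatching ≡ s
  F-tunnelMatching = trans (tabulate-cong {n = N} opens₀) (tabulate∘lookup s)

  isTunnel⇒Tunnel : ∀ i j → isTunnel {n} s i j ≡ true → Tunnel i j
  isTunnel⇒Tunnel i j holds = record
    { i<j   = <ᵇ≡true⇒< (proj₁ c₁)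
    ; up    = proj₁ c₂
    ; down  = not-injective (proj₁ c₃)
    ; level = ≡ᵇ⇒≡ _ _ (Equivalence.from T-≡ (proj₁ c₄))
    ; under = stays-above }
    where
    c₁ = ∧-true⁻¹ {i <F j} holds
    c₂ = ∧-true⁻¹ {lookup s i} (proj₂ c₁)
    c₃ = ∧-true⁻¹ {not (lookup s j)} (proj₂ c₂)
    c₄ = ∧-true⁻¹ {ht (toℕ i) ≡ᵇ ht (suc (toℕ j))} (proj₂ c₃)
    above-at : ∀ (k : Fin N) → toℕ i < toℕ k → toℕ k ≤ toℕ j → ht (toℕ i) < ht (toℕ k)
    above-at k i<k k≤j with allF⇒∀ (proj₂ c₄) k
    ... | above rewrite <⇒<ᵇ≡true i<k | ≤⇒<ᵇ≡false k≤j = <ᵇ≡true⇒< above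
    stays-above : ∀ m → toℕ i < m → m ≤ toℕ j → ht (toℕ i) < ht m
    stays-above m i<m m≤j = subst (λ k → ht (toℕ i) < ht k) toℕ-m
      (above-at (fromℕ< m<N) (subst (toℕ i <_) (sym toℕ-m) i<m) (subst (_≤ toℕ j) (sym toℕ-m) m≤j))
      where
      m<N = ≤-<-trans m≤j (Finₚ.toℕ<n j)
      toℕ-m = Finₚ.toℕ-fromℕ< m<N

  mutual
    Tunnel⇒isTunnel : ∀ {i j} → Tunnel i j → isTunnel {n} s i j ≡ true
    Tunnel⇒isTunnel {i} {j} t =
      ∧-true (<⇒<ᵇ≡true (i<j t)) (∧-true (up t) (∧-true (cong not (down t))
        (∧-true (Equivalence.to T-≡ (≡⇒≡ᵇ _ _ (level t))) (∀⇒allF (above-guarded t)))))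

    -- The type is that of the last conjunct of isTunnel, which mentions a function local to Defs.
    above-guarded : ∀ {i j} → Tunnel i j → ∀ m → _
    above-guarded {i} {j} t m with (i <F m) ∧ (m ≤F j) in guard
    ... | false = refl
    ... | true  = <⇒<ᵇ≡true (under t (toℕ m) (<ᵇ≡true⇒< (proj₁ g)) (<ᵇ≡false⇒≥ (not-injective (proj₂ g))))
      where g = ∧-true⁻¹ {i <F m} guard

  isTunnel≡edge : ∀ i j → isTunnel {n} s i j ≡ MatchingProperties.edge tunnelMatching i j
  isTunnel≡edge i j with isTunnel {n} s i j in tunnel
  ... | true = sym (trans (cong₂ _∧_ (trans (opens₀ i) (up t)) (cong (_==F j) P₀i≡j)) (==F-refl j))
    where
    t = isTunnel⇒Tunnel i j tunnel
    P₀i≡j = Tunnel-uniqueʳ (partner₀-up i (up t)) t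
  ... | false with true-or-false (lookup s i)
  ...   | inj₂ step = sym (cong (_∧ (partner₀ i ==F j)) (trans (opens₀ i) step))
  ...   | inj₁ step = sym (cong₂ _∧_ (trans (opens₀ i) step) (≢⇒==F≡false λ P₀i≡j →
          contradiction (trans (sym tunnel) (Tunnel⇒isTunnel (subst (Tunnel i) P₀i≡j (partner₀-up i step)))) λ ()))

  neD≡neM-tunnelMatching : neD {n} s ≡ neM tunnelMatching
  neD≡neM-tunnelMatching =
    trans (sumF-cong λ a → sumF-cong λ b → sumF-cong λ c → sumF-cong λ d → cong 𝟙
            (cong₂ (λ x y → x ∧ y ∧ not ((a ==F c) ∧ (b ==F d)) ∧ (a ≤F c) ∧ (d ≤F b))
                   (isTunnel≡edge a b) (isTunnel≡edge c d)))
          (MatchingProperties.count-covers≡neM tunnelMatching)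

  tunnelMatching-nonCrossing : MatchingProperties.NonCrossing tunnelMatching
  tunnelMatching-nonCrossing a b a-opens b-opens a<b b<P₀a with <-cmp (toℕ (partner₀ b)) (toℕ (partner₀ a))
  ... | tri< P₀b<P₀a _ _ = P₀b<P₀a
  ... | tri≈ _ P₀b≡P₀a _ =
    contradiction a<b (<-irrefl (cong toℕ (sym (partner₀-injective (Finₚ.toℕ-injective P₀b≡P₀a)))))
    where open MatchingProperties tunnelMatching using () renaming (partner-injective to partner₀-injective)
  ... | tri> _ _ P₀a<P₀b =
    contradiction (under ta (toℕ b) a<b (<⇒≤ b<P₀a))
                  (<⇒≯ (subst (ht (toℕ b) <_) (sym (level ta)) (under tb _ (m<n⇒m<1+n b<P₀a) P₀a<P₀b)))
    where
    ta = partner₀-up a (trans (sym (opens₀ a)) a-opens)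
    tb = partner₀-up b (trans (sym (opens₀ b)) b-opens)

  neM≤neD : (M : Matching n) → F M ≡ s → neM M ≤ neD {n} s
  neM≤neD M FM≡s = begin
      neM M                              ≤⟨ neM≤openerDepths ⟩
      openerDepths                       ≡⟨ openerDepths≡upStepHeights ⟩
      upStepHeights {n} (F M)            ≡⟨ cong (upStepHeights {n}) (trans FM≡s (sym F-tunnelMatching)) ⟩
      upStepHeights {n} (F tunnelMatching) ≡⟨ M₀.openerDepths≡upStepHeights ⟨
      M₀.openerDepths                    ≡⟨ M₀.neM≡openerDepths tunnelMatching-nonCrossing ⟨
      neM tunnelMatching                 ≡⟨ neD≡neM-tunnelMatching ⟨
      neD {n} s                          ∎
    where
    open ≤-Reasoning
    open MatchingProperties M
    module M₀ = MatchingProperties tunnelMatching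

-- Untangling a nesting

module Untangling {n : ℕ} (M : Matching n) where
  open MatchingProperties M

  record AdjacentNestedClosers : Set where
    field
      c c′      : Fin (2 * n)
      c-closes  : opens c ≡ false
      c′-closes : opens c′ ≡ false
      c<c′      : toℕ c < toℕ c′
      nested    : toℕ (P c′) < toℕ (P c)
      adjacent  : ∀ w → opens w ≡ false → toℕ c < toℕ w → toℕ w < toℕ c′ → ⊥

  -- Any closer strictly between two nested closers u < v nests with one of them.
  adjacentNestedClosers-between : ∀ d u v → toℕ v ≤ toℕ u + d → opens u ≡ false → opens v ≡ false →
    toℕ u < toℕ v → toℕ (P v) < toℕ (P u) → AdjacentNestedClosers
  adjacentNestedClosers-between zero u v v≤u u-closes v-closes u<v nested =
    contradiction (subst (toℕ v ≤_) (+-identityʳ _) v≤u) (<⇒≱ u<v)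
  adjacentNestedClosers-between (suc d) u v v≤u+d u-closes v-closes u<v nested
    with Finₚ.any? (λ w → (opens w Boolₚ.≟ false) ×-dec (toℕ u <? toℕ w) ×-dec (toℕ w <? toℕ v))
  ... | no nothing-between = record
    { c = u ; c′ = v ; c-closes = u-closes ; c′-closes = v-closes ; c<c′ = u<v ; nested = nested
    ; adjacent = λ w w-closes u<w w<v → nothing-between (w , w-closes , u<w , w<v) }
  ... | yes (w , w-closes , u<w , w<v) with <-cmp (toℕ (P w)) (toℕ (P u))
  ...   | tri< Pw<Pu _ _ = adjacentNestedClosers-between d u w
          (s≤s⁻¹ (≤-trans w<v (subst (toℕ v ≤_) (+-suc (toℕ u) d) v≤u+d))) u-closes w-closes u<w Pw<Pu
  ...   | tri≈ _ Pw≡Pu _ = contradiction (cong toℕ (partner-injective (Finₚ.toℕ-injective Pw≡Pu))) (>⇒≢ u<w)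
  ...   | tri> _ _ Pw>Pu = adjacentNestedClosers-between d w v
          (≤-trans v≤u+d (subst (_≤ toℕ w + d) (sym (+-suc (toℕ u) d)) (+-monoˡ-≤ d u<w)))
          w-closes v-closes w<v (<-trans nested Pw>Pu)

  adjacentNestedClosers : 0 < neM M → AdjacentNestedClosers
  adjacentNestedClosers neM>0 with sumF-pos⇒∃pos {f = count ∘ nests} neM>0
  ... | a , count>0 with sumF-pos⇒∃pos {f = 𝟙 ∘ nests a} count>0
  ...   | b , nests>0 = adjacentNestedClosers-between (toℕ (P a)) (P b) (P a) (m≤n+m _ _)
          (partner-of-opener-closes b-opens) (partner-of-opener-closes a-opens)
          (<ᵇ≡true⇒< {toℕ (P b)} Pb<Pa)
          (subst₂ (λ x y → toℕ x < toℕ y) (sym (involutive M a)) (sym (involutive M b)) (<ᵇ≡true⇒< {toℕ a} a<b))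
    where
    c₁ = ∧-true⁻¹ {opens a} (𝟙-pos⇒true nests>0)
    a-opens = proj₁ c₁
    c₂ = ∧-true⁻¹ {opens b} (proj₂ c₁)
    b-opens = proj₁ c₂
    c₃ = ∧-true⁻¹ {a <F b} (proj₂ c₂)
    a<b = proj₁ c₃
    Pb<Pa = proj₂ (∧-true⁻¹ {opens b} (proj₂ c₃))

  module SwapClosers (adj : AdjacentNestedClosers) where
    open AdjacentNestedClosers adj

    c≢c′ : c ≢ c′
    c≢c′ c≡c′ = <-irrefl (cong toℕ c≡c′) c<c′

    σ : Fin (2 * n) → Fin (2 * n)
    σ = transpose c c′

    σ-c : σ c ≡ c′
    σ-c rewrite dec-true (c ≟ c) refl = refl

    σ-c′ : σ c′ ≡ c
    σ-c′ rewrite dec-false (c′ ≟ c) (c≢c′ ∘ sym) | dec-true (c′ ≟ c′) refl = refl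

    σ-elsewhere : ∀ {x} → x ≢ c → x ≢ c′ → σ x ≡ x
    σ-elsewhere {x} x≢c x≢c′ rewrite dec-false (x ≟ c) x≢c | dec-false (x ≟ c′) x≢c′ = refl

    data Position (x : Fin (2 * n)) : Set where
      at-c      : x ≡ c → Position x
      at-c′     : x ≡ c′ → Position x
      elsewhere : x ≢ c → x ≢ c′ → Position x

    position : ∀ x → Position x
    position x with x ≟ c | x ≟ c′
    ... | yes x≡c | _        = at-c x≡c
    ... | no x≢c  | yes x≡c′ = at-c′ x≡c′
    ... | no x≢c  | no x≢c′  = elsewhere x≢c x≢c′

    σ-involutive : ∀ x → σ (σ x) ≡ x
    σ-involutive x with position x
    ... | at-c refl        = trans (cong σ σ-c) σ-c′
    ... | at-c′ refl       = trans (cong σ σ-c′) σ-c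
    ... | elsewhere x≢c x≢c′ = trans (cong σ (σ-elsewhere x≢c x≢c′)) (σ-elsewhere x≢c x≢c′)

    σ-opener : ∀ {x} → opens x ≡ true → σ x ≡ x
    σ-opener x-opens = σ-elsewhere (opener≢closer x-opens c-closes) (opener≢closer x-opens c′-closes)

    p p′ : Fin (2 * n)
    p  = P c
    p′ = P c′

    p<c : toℕ p < toℕ c
    p<c = <ᵇ≡true⇒< {toℕ p} (trans (sym (not-opens c)) (cong not c-closes))

    p′<c : toℕ p′ < toℕ c
    p′<c = <-trans nested p<c

    closer-outside : ∀ {y} → opens y ≡ false → y ≢ c → y ≢ c′ → toℕ y < toℕ c ⊎ toℕ c′ < toℕ y
    closer-outside {y} y-closes y≢c y≢c′ with <-cmp (toℕ y) (toℕ c) | <-cmp (toℕ y) (toℕ c′)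
    ... | tri< y<c _ _ | _              = inj₁ y<c
    ... | tri≈ _ y≡c _ | _              = contradiction (Finₚ.toℕ-injective y≡c) y≢c
    ... | tri> _ _ _   | tri> _ _ c′<y  = inj₂ c′<y
    ... | tri> _ _ _   | tri≈ _ y≡c′ _  = contradiction (Finₚ.toℕ-injective y≡c′) y≢c′
    ... | tri> _ _ c<y | tri< y<c′ _ _  = ⊥-elim (adjacent y y-closes c<y y<c′)

    partner′ : Fin (2 * n) → Fin (2 * n)
    partner′ x = σ (P (σ x))

    swapped : Matching n
    swapped = record
      { partner      = partner′
      ; involutive   = λ x → trans (cong (σ ∘ P) (σ-involutive (P (σ x))))
                                   (trans (cong σ (involutive M (σ x))) (σ-involutive x))
      ; fixpointFree = λ x P′x≡x → fixpointFree M (σ x) (trans (sym (σ-involutive (P (σ x)))) (cong σ P′x≡x)) }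

    partner′-opener : ∀ {x} → opens x ≡ true → partner′ x ≡ σ (P x)
    partner′-opener x-opens = cong (σ ∘ P) (σ-opener x-opens)

    opens′≡opens : ∀ x → (x <F partner′ x) ≡ opens x
    opens′≡opens x with true-or-false (opens x)
    ... | inj₁ x-opens = trans (cong (x <F_) (partner′-opener x-opens)) (trans x<σPx (sym x-opens))
      where
      x<σPx : (x <F σ (P x)) ≡ true
      x<σPx with position (P x)
      ... | at-c Px≡c   rewrite Px≡c  | σ-c  | partner-swap Px≡c  = <⇒<ᵇ≡true (<-trans p<c c<c′)
      ... | at-c′ Px≡c′ rewrite Px≡c′ | σ-c′ | partner-swap Px≡c′ = <⇒<ᵇ≡true p′<c
      ... | elsewhere Px≢c Px≢c′ rewrite σ-elsewhere Px≢c Px≢c′ = x-opens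
    ... | inj₂ x-closes with position x
    ...   | at-c refl rewrite σ-c | σ-opener (partner-of-closer-opens c′-closes) =
            trans (≤⇒<ᵇ≡false (<⇒≤ p′<c)) (sym x-closes)
    ...   | at-c′ refl rewrite σ-c′ | σ-opener (partner-of-closer-opens c-closes) =
            trans (≤⇒<ᵇ≡false (<⇒≤ (<-trans p<c c<c′))) (sym x-closes)
    ...   | elsewhere x≢c x≢c′ rewrite σ-elsewhere x≢c x≢c′ | σ-opener (partner-of-closer-opens x-closes) = refl

    F-swapped : F swapped ≡ F M
    F-swapped = tabulate-cong {n = 2 * n} opens′≡opens

    InPair : Fin (2 * n) → Set
    InPair z = z ≡ c ⊎ z ≡ c′

    -- Since no closer lies strictly between c and c′, other closers compare alike with both.
    pair-<F-closer : ∀ {y z} → opens y ≡ false → y ≢ c → y ≢ c′ → InPair z → (z <F y) ≡ (c <F y)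
    pair-<F-closer y-closes y≢c y≢c′ (inj₁ refl) = refl
    pair-<F-closer y-closes y≢c y≢c′ (inj₂ refl) with closer-outside y-closes y≢c y≢c′
    ... | inj₁ y<c  = trans (≤⇒<ᵇ≡false (<⇒≤ (<-trans y<c c<c′))) (sym (≤⇒<ᵇ≡false (<⇒≤ y<c)))
    ... | inj₂ c′<y = trans (<⇒<ᵇ≡true c′<y) (sym (<⇒<ᵇ≡true (<-trans c<c′ c′<y)))

    closer-<F-pair : ∀ {y z} → opens y ≡ false → y ≢ c → y ≢ c′ → InPair z → (y <F z) ≡ (y <F c)
    closer-<F-pair y-closes y≢c y≢c′ (inj₁ refl) = refl
    closer-<F-pair y-closes y≢c y≢c′ (inj₂ refl) with closer-outside y-closes y≢c y≢c′
    ... | inj₁ y<c  = trans (<⇒<ᵇ≡true (<-trans y<c c<c′)) (sym (<⇒<ᵇ≡true y<c))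
    ... | inj₂ c′<y = trans (≤⇒<ᵇ≡false (<⇒≤ c′<y)) (sym (≤⇒<ᵇ≡false (<⇒≤ (<-trans c<c′ c′<y))))

    σ-<F : ∀ {x y} → opens x ≡ false → opens y ≡ false →
      ¬ (x ≡ c × y ≡ c′) → ¬ (x ≡ c′ × y ≡ c) → (σ x <F σ y) ≡ (x <F y)
    σ-<F {x} {y} x-closes y-closes not-cc′ not-c′c with position x | position y
    ... | at-c refl  | at-c refl  rewrite σ-c  = trans (<ᵇ-self (toℕ c′)) (sym (<ᵇ-self (toℕ c)))
    ... | at-c′ refl | at-c′ refl rewrite σ-c′ = trans (<ᵇ-self (toℕ c)) (sym (<ᵇ-self (toℕ c′)))
    ... | at-c refl  | at-c′ refl = ⊥-elim (not-cc′ (refl , refl))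
    ... | at-c′ refl | at-c refl  = ⊥-elim (not-c′c (refl , refl))
    ... | at-c refl  | elsewhere y≢c y≢c′ rewrite σ-elsewhere y≢c y≢c′ =
      trans (pair-<F-closer y-closes y≢c y≢c′ (inj₂ σ-c)) (sym (pair-<F-closer y-closes y≢c y≢c′ (inj₁ refl)))
    ... | at-c′ refl | elsewhere y≢c y≢c′ rewrite σ-elsewhere y≢c y≢c′ =
      trans (pair-<F-closer y-closes y≢c y≢c′ (inj₁ σ-c′)) (sym (pair-<F-closer y-closes y≢c y≢c′ (inj₂ refl)))
    ... | elsewhere x≢c x≢c′ | at-c refl rewrite σ-elsewhere x≢c x≢c′ =
      trans (closer-<F-pair x-closes x≢c x≢c′ (inj₂ σ-c)) (sym (closer-<F-pair x-closes x≢c x≢c′ (inj₁ refl)))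
    ... | elsewhere x≢c x≢c′ | at-c′ refl rewrite σ-elsewhere x≢c x≢c′ =
      trans (closer-<F-pair x-closes x≢c x≢c′ (inj₁ σ-c′)) (sym (closer-<F-pair x-closes x≢c x≢c′ (inj₂ refl)))
    ... | elsewhere x≢c x≢c′ | elsewhere y≢c y≢c′ rewrite σ-elsewhere x≢c x≢c′ | σ-elsewhere y≢c y≢c′ = refl

    nests′ : Fin (2 * n) → Fin (2 * n) → Bool
    nests′ = MatchingProperties.nests swapped

    nests′-openers : ∀ a b →
      nests′ a b ≡ (opens a ∧ (opens b ∧ ((a <F b) ∧ (opens b ∧ (partner′ b <F partner′ a)))))
    nests′-openers a b rewrite opens′≡opens a | opens′≡opens b = refl

    nesting-preserved : ∀ a b → opens a ≡ true → opens b ≡ true → ¬ (a ≡ p′ × b ≡ p) →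
      ((a <F b) ∧ (P b <F P a)) ≡ ((a <F b) ∧ (σ (P b) <F σ (P a)))
    nesting-preserved a b a-opens b-opens not-p′p with a <F b in a<b
    ... | false = refl
    ... | true  = sym (σ-<F (partner-of-opener-closes b-opens) (partner-of-opener-closes a-opens)
      (λ (Pb≡c , Pa≡c′) → not-p′p (partner-swap Pa≡c′ , partner-swap Pb≡c))
      (λ (Pb≡c′ , Pa≡c) → <-asym nested (subst₂ (λ x y → toℕ x < toℕ y)
                                                 (partner-swap Pa≡c) (partner-swap Pb≡c′) (<ᵇ≡true⇒< a<b))))

    -- The only nesting destroyed by the swap is (p′ , p), which becomes a crossing.
    nests-between-openers : ∀ a b → opens a ≡ true → opens b ≡ true →
      𝟙 ((a <F b) ∧ (P b <F P a)) ≡ 𝟙 ((a <F b) ∧ (σ (P b) <F σ (P a))) + 𝟙 ((a ==F p′) ∧ (b ==F p))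
    nests-between-openers a b a-opens b-opens with a ≟ p′ | b ≟ p
    ... | yes refl | yes refl
      rewrite involutive M c | involutive M c′ | σ-c | σ-c′ | <⇒<ᵇ≡true nested
            | <⇒<ᵇ≡true c<c′ | ≤⇒<ᵇ≡false (<⇒≤ c<c′) = refl
    ... | yes a≡p′ | no b≢p =
      trans (cong 𝟙 (nesting-preserved a b a-opens b-opens (b≢p ∘ proj₂))) (sym (+-identityʳ _))
    ... | no a≢p′  | _      =
      trans (cong 𝟙 (nesting-preserved a b a-opens b-opens (a≢p′ ∘ proj₁))) (sym (+-identityʳ _))

    nests-split : ∀ a b → 𝟙 (nests a b) ≡ 𝟙 (nests′ a b) + 𝟙 ((a ==F p′) ∧ (b ==F p))
    nests-split a b rewrite nests′-openers a b with opens a in a-opens | opens b in b-opens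
    ... | false | _
      rewrite ≢⇒==F≡false (opener≢closer (partner-of-closer-opens c′-closes) a-opens ∘ sym) = refl
    ... | true  | false
      rewrite ≢⇒==F≡false (opener≢closer (partner-of-closer-opens c-closes) b-opens ∘ sym)
            | ∧-zeroʳ (a ==F p′) = refl
    ... | true  | true
      rewrite partner′-opener a-opens | partner′-opener b-opens = nests-between-openers a b a-opens b-opens

    neM≡suc-neM-swapped : neM M ≡ suc (neM swapped)
    neM≡suc-neM-swapped = begin
        sumF (λ a → sumF (λ b → 𝟙 (nests a b)))
      ≡⟨ sumF-cong (λ a → trans (sumF-cong (nests-split a))
                                (sumF-+ (𝟙 ∘ nests′ a) (λ b → 𝟙 ((a ==F p′) ∧ (b ==F p))))) ⟩
        sumF (λ a → count (nests′ a) + sumF (λ b → 𝟙 ((a ==F p′) ∧ (b ==F p))))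
      ≡⟨ sumF-+ (count ∘ nests′) (λ a → sumF (λ b → 𝟙 ((a ==F p′) ∧ (b ==F p)))) ⟩
        neM swapped + sumF (λ a → sumF (λ b → 𝟙 ((a ==F p′) ∧ (b ==F p))))
      ≡⟨ cong (neM swapped +_) (trans (sumF-cong (λ a → count-single p (a ==F p′))) (count-single p′ true)) ⟩
        neM swapped + 1
      ≡⟨ +-comm (neM swapped) 1 ⟩
        suc (neM swapped)
      ∎
      where open ≡-Reasoning

  nesting-decreasing : ∀ k → neM M ≡ suc k → Σ (Matching n) λ M′ → F M′ ≡ F M × neM M′ ≡ k
  nesting-decreasing k neM≡1+k =
    swapped , F-swapped , suc-injective (trans (sym neM≡suc-neM-swapped) neM≡1+k)
    where open SwapClosers (adjacentNestedClosers (subst (0 <_) (sym neM≡1+k) z<s))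

descend : ∀ {n} i d (M : Matching n) → neM M ≡ i + d → Σ (Matching n) λ M′ → F M′ ≡ F M × neM M′ ≡ i
descend i zero    M neM≡i   = M , refl , trans neM≡i (+-identityʳ i)
descend i (suc d) M neM≡i+d =
  let (M₁ , FM₁≡FM , neM₁≡i+d) = Untangling.nesting-decreasing M (i + d) (trans neM≡i+d (+-suc i d))
      (M₂ , FM₂≡FM₁ , neM₂≡i)  = descend i d M₁ neM₁≡i+d
  in  M₂ , trans FM₂≡FM₁ FM₁≡FM , neM₂≡i

F-determines-nes : ∀ {n} (M M′ : Matching n) → F M ≡ F M′ → nes M ≡ nes M′
F-determines-nes {n} M M′ FM≡FM′ =
  trans (MatchingProperties.nes≡dos∘F M) (trans (cong (dos {n}) FM≡FM′) (sym (MatchingProperties.nes≡dos∘F M′)))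

nes-determines-F : ∀ {n} (M M′ : Matching n) → nes M ≡ nes M′ → F M ≡ F M′
nes-determines-F {n} M M′ nesM≡nesM′ = dos-injective {n} (F M) (F M′)
  (trans (sym (MatchingProperties.nes≡dos∘F M)) (trans nesM≡nesM′ (MatchingProperties.nes≡dos∘F M′)))

nes↔Dyck : ∀ n → Bijection (NesSetoid n) (DyckSetoid n)
nes↔Dyck n = record
  { to        = λ (_ , M , _) → F M , MatchingProperties.F-isDyck M
  ; cong      = λ {(_ , M , nesM≡v)} {(_ , M′ , nesM′≡v′)} v≡v′ →
                  nes-determines-F M M′ (trans nesM≡v (trans v≡v′ (sym nesM′≡v′)))
  ; bijective = (λ {x} {y} → injective {x} {y}) , surjective }
  where
  injective : ∀ {x y : NesSet n} → F (proj₁ (proj₂ x)) ≡ F (proj₁ (proj₂ y)) → proj₁ x ≡ proj₁ y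
  injective {_ , M , nesM≡v} {_ , M′ , nesM′≡v′} FM≡FM′ =
    trans (sym nesM≡v) (trans (F-determines-nes M M′ FM≡FM′) nesM′≡v′)
  surjective : ∀ (D : DyckPath n) →
    Σ (NesSet n) λ x → ∀ {z : NesSet n} → proj₁ z ≡ proj₁ x → F (proj₁ (proj₂ z)) ≡ proj₁ D
  surjective (s , dyck) = (nes M₀ , M₀ , refl) , λ {(_ , M , nesM≡v)} v≡nesM₀ →
      trans (nes-determines-F M M₀ (trans nesM≡v v≡nesM₀)) F-tunnelMatching
    where
    open DyckProperties {n} s dyck using (F-tunnelMatching) renaming (tunnelMatching to M₀)

neM-attains : ∀ {n} (D : DyckPath n) i → i ≤ neD {n} (proj₁ D) →
  Σ (Matching n) λ M → F M ≡ proj₁ D × neM M ≡ i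
neM-attains {n} (s , dyck) i i≤neD =
  let (M , FM≡FM₀ , neM≡i) = descend i (neD {n} s ∸ i) M₀
                               (trans (sym neD≡neM-tunnelMatching) (sym (m+[n∸m]≡n i≤neD)))
  in  M , trans FM≡FM₀ F-tunnelMatching , neM≡i
  where open DyckProperties {n} s dyck renaming (tunnelMatching to M₀)

neM-bounded : ∀ {n} (D : DyckPath n) → ¬ Σ (Matching n) λ M → F M ≡ proj₁ D × neD {n} (proj₁ D) < neM M
neM-bounded (s , dyck) (M , FM≡s , neD<neM) = <⇒≱ neD<neM (DyckProperties.neM≤neD s dyck M FM≡s)

lemma3p4 : (n : ℕ) →
    ( ((M : Matching n) → nes M ≡ dos {n} (F M))
      × Bijection (NesSetoid n) (DyckSetoid n) )
    × ((D : DyckPath n) →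
        ((i : ℕ) → i ≤ neD {n} (proj₁ D) →
          Σ (Matching n) (λ M → (F M ≡ proj₁ D) × (neM M ≡ i)))
        × ¬ Σ (Matching n) (λ M → (F M ≡ proj₁ D) × (neD {n} (proj₁ D) < neM M)))
lemma3p4 n = ((MatchingProperties.nes≡dos∘F , nes↔Dyck n) , λ D → neM-attains D , neM-bounded D)
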